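{- For every two positive integers $L_1$ and $L_2$ with $L_1 < L_2$, there exists a disconnected graph $G$ such that $\chi(G) = L_1$ and $\chi^{\mathrm{FAT}}(G) = L_2$.
   Context: All graphs are simple with a finite nonempty vertex set. $\chi(G)$ denotes the chromatic number of $G$. For a vertex $v$ and a set $S\subseteq V(G)$, let $e(v,S)=|S\cap N(v)|$, where $N(v)$ is the set of neighbors of $v$ and $\deg(v)=|N(v)|$. A (not necessarily proper) vertex coloring of $G$ with color classes $V_1,\dots,V_k$ is a Fair And Tolerant (FAT) $k$-coloring if $V_1,\dots,V_k$ are all nonempty, they partition $V(G)$, and there exist real numbers $\alpha,\beta\in[0,1]$ such that for every vertex $v$ and every $i\in\{1,\dots,k\}$: $e(v,V_i)=\alpha\deg(v)$ if $v\notin V_i$, and $e(v,V_i)=\beta\deg(v)$ if $v\in V_i$. The FAT chromatic number $\chi^{\mathrm{FAT}}(G)$ is the maximum $k$ such that $G$ admits a FAT $k$-coloring (a FAT $1$-coloring always exists).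
   Formalization: In a FAT coloring, the numbers α and β range over the rationals in [0,1] instead of the reals. -}

module Defs where

open import Data.Nat using (ℕ; zero; suc; _≤_; _<_; NonZero)
open import Data.Bool using (Bool; true; false; _∧_; if_then_else_)
open import Data.Fin using (Fin; _≟_)
open import Data.List using (List; map; allFin)
open import Data.Nat.ListAction using (sum)
open import Data.Integer using (+_)
open import Data.Rational using (ℚ; _/_; _*_; 0ℚ; 1ℚ) renaming (_≤_ to _≤ℚ_)
open import Data.Product using (Σ; ∃; _×_; _,_)
open import Relation.Nullary using (¬_)
open import Relation.Nullary.Decidable using (⌊_⌋)
open import Relation.Binary.PropositionalEquality using (_≡_; _≢_)

record Graph : Set where
  field
    n        : ℕ
    nonempty : 1 ≤ n
    adj      : Fin n → Fin n → Bool
    adj-sym  : ∀ u v → adj u v ≡ adj v u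
    irrefl   : ∀ v → adj v v ≡ false

module _ (G : Graph) where
  open Graph G

  data Reach : Fin n → Fin n → Set where
    here : ∀ {v} → Reach v v
    step : ∀ {u w v} → adj u w ≡ true → Reach w v → Reach u v

  Connected : Set
  Connected = ∀ u v → Reach u v

  Disconnected : Set
  Disconnected = Σ (Fin n) λ u → Σ (Fin n) λ v → ¬ Reach u v

  deg : Fin n → ℕ
  deg v = sum (map (λ w → if adj v w then 1 else 0) (allFin n))

  eClass : ∀ {k} → (Fin n → Fin k) → Fin n → Fin k → ℕ
  eClass c v i = sum (map (λ w → if adj v w ∧ ⌊ c w ≟ i ⌋ then 1 else 0) (allFin n))

  ProperColoring : ℕ → Set
  ProperColoring k = Σ (Fin n → Fin k) λ c → ∀ u v → adj u v ≡ true → c u ≢ c v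

  IsChromaticNumber : ℕ → Set
  IsChromaticNumber L = ProperColoring L × (∀ k → ProperColoring k → L ≤ k)

  ℕtoℚ : ℕ → ℚ
  ℕtoℚ m = (+ m) / 1

  IsFATColoring : ∀ {k} → (Fin n → Fin k) → Set
  IsFATColoring {k} c =
    (∀ i → ∃ λ v → c v ≡ i) ×
    Σ ℚ λ α → Σ ℚ λ β →
      (0ℚ ≤ℚ α) × (α ≤ℚ 1ℚ) × (0ℚ ≤ℚ β) × (β ≤ℚ 1ℚ) ×
      (∀ v i → (c v ≢ i → ℕtoℚ (eClass c v i) ≡ α * ℕtoℚ (deg v))
             × (c v ≡ i → ℕtoℚ (eClass c v i) ≡ β * ℕtoℚ (deg v)))

  HasFATColoring : ℕ → Set
  HasFATColoring k = Σ (Fin n → Fin k) IsFATColoring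

  IsFATChromaticNumber : ℕ → Set
  IsFATChromaticNumber L = HasFATColoring L × (∀ k → HasFATColoring k → k ≤ L)

-- Take p isolated vertices next to a clique K on m + 1 vertices, where m < p.  The clique makes
-- the chromatic number m + 1, and the graph is disconnected.  Giving every isolated vertex its own
-- colour and the whole clique one further colour is FAT with α = 0 and β = 1, so χ^FAT ≥ p + 1.
-- Conversely, take a FAT colouring and a clique vertex v.  If the clique is monochromatic, every
-- colour is the colour of v or of an isolated vertex, so there are at most p + 1 colours.
-- Otherwise v sees some foreign colour, and fairness forces e(v, V_i) to be the same positive
-- number for every foreign colour i; so every colour occurs in the clique and there are at most
-- m + 1 ≤ p colours.
module Submission where

open import Defs
open import Data.Nat using (ℕ; zero; suc; _+_; _≤_; _<_; z≤n; s≤s)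
import Data.Nat.Properties as ℕP
import Data.Nat.Coprimality as Coprimality
open import Data.Bool using (Bool; true; false; not; _∧_; if_then_else_)
import Data.Bool.Properties as BoolP
open import Data.Fin using (Fin; zero; suc; _≟_; _↑ˡ_; _↑ʳ_; splitAt; fromℕ<)
open import Data.Fin.Properties
  using (any?; all?; ¬∀⟶∃¬; injective⇒≤; splitAt-↑ˡ; splitAt-↑ʳ; splitAt⁻¹-↑ˡ; splitAt⁻¹-↑ʳ)
open import Data.List using (List; []; _∷_; map; allFin)
open import Data.List.Properties using (map-cong)
open import Data.List.Relation.Unary.Any using (here; there)
open import Data.List.Membership.Propositional using (_∈_)
open import Data.List.Membership.Propositional.Properties using (∈-allFin)
open import Data.Nat.ListAction using (sum)
open import Data.Integer using (+_)
import Data.Integer.Properties as ℤP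
open import Data.Rational using (mkℚ; ↥_; 0ℚ; 1ℚ)
import Data.Rational.Properties as ℚP
open import Data.Product using (Σ; ∃; ∃₂; _×_; _,_; proj₁; proj₂)
open import Data.Sum using (_⊎_; inj₁; inj₂; [_,_]′)
open import Function using (const; id)
open import Function.Definitions using (StrictlySurjective)
open import Relation.Binary.PropositionalEquality
open import Relation.Nullary using (¬_; Dec; yes; no; contradiction; _×-dec_)
open import Relation.Nullary.Decidable using (⌊_⌋)

sum-map≡0 : ∀ {A : Set} (f : A → ℕ) → (∀ x → f x ≡ 0) → ∀ xs → sum (map f xs) ≡ 0
sum-map≡0 f f≡0 []       = refl
sum-map≡0 f f≡0 (x ∷ xs) = cong₂ _+_ (f≡0 x) (sum-map≡0 f f≡0 xs)

sum-map≡0⇒ : ∀ {A : Set} (f : A → ℕ) {x : A} {xs : List A} → sum (map f xs) ≡ 0 → x ∈ xs → f x ≡ 0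
sum-map≡0⇒ f {xs = y ∷ ys} s≡0 (here refl) = ℕP.m+n≡0⇒m≡0 (f y) s≡0
sum-map≡0⇒ f {xs = y ∷ ys} s≡0 (there x∈ys) = sum-map≡0⇒ f (ℕP.m+n≡0⇒n≡0 (f y) s≡0) x∈ys

strictlySurjective⇒≥ : ∀ {a k} (f : Fin a → Fin k) → StrictlySurjective _≡_ f → k ≤ a
strictlySurjective⇒≥ f surj = injective⇒≤ {f = λ i → proj₁ (surj i)}
  λ {i} {j} eq → trans (sym (proj₂ (surj i))) (trans (cong f eq) (proj₂ (surj j)))

module _ (G : Graph) where
  open Graph G

  ℕtoℚ-injective : ∀ {a b} → ℕtoℚ G a ≡ ℕtoℚ G b → a ≡ b
  ℕtoℚ-injective {a} {b} eq = ℤP.+-injective (cong ↥_ (trans (sym (canonical a)) (trans eq (canonical b))))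
    where
    canonical : ∀ a → ℕtoℚ G a ≡ mkℚ (+ a) 0 (Coprimality.sym (Coprimality.1-coprimeTo a))
    canonical a = ℚP.normalize-coprime _

  isolated⇒¬Reach : ∀ {v u} → (∀ w → adj v w ≡ false) → v ≢ u → ¬ Reach G v u
  isolated⇒¬Reach isolated v≢u here         = v≢u refl
  isolated⇒¬Reach isolated v≢u (step vw _) = contradiction (trans (sym (isolated _)) vw) λ ()

  clique⇒χ≥ : ∀ {K k} (f : Fin K → Fin n) → (∀ i j → i ≢ j → adj (f i) (f j) ≡ true) →
              ProperColoring G k → K ≤ k
  clique⇒χ≥ f clique (c , proper) = injective⇒≤ {f = λ i → c (f i)} injective
    where
    injective : ∀ {i j} → c (f i) ≡ c (f j) → i ≡ j
    injective {i} {j} eq with i ≟ j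
    ... | yes i≡j = i≡j
    ... | no  i≢j = contradiction eq (proper (f i) (f j) (clique i j i≢j))

  module _ {k} (c : Fin n → Fin k) where

    eClass≡0 : ∀ v i → (∀ w → adj v w ≡ true → c w ≢ i) → eClass G c v i ≡ 0
    eClass≡0 v i none = sum-map≡0 _ term (allFin n)
      where
      term : ∀ w → (if adj v w ∧ ⌊ c w ≟ i ⌋ then 1 else 0) ≡ 0
      term w with adj v w in vw | c w ≟ i
      ... | false | _        = refl
      ... | true  | no  _    = refl
      ... | true  | yes cw≡i = contradiction cw≡i (none w vw)

    eClass≡deg : ∀ v i → (∀ w → adj v w ≡ true → c w ≡ i) → eClass G c v i ≡ deg G v
    eClass≡deg v i all = cong sum (map-cong term (allFin n))
      where
      term : ∀ w → (if adj v w ∧ ⌊ c w ≟ i ⌋ then 1 else 0) ≡ (if adj v w then 1 else 0)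
      term w with adj v w in vw | c w ≟ i
      ... | false | _        = refl
      ... | true  | yes _    = refl
      ... | true  | no  cw≢i = contradiction (all w vw) cw≢i

    eClass≢0 : ∀ {v w i} → adj v w ≡ true → c w ≡ i → eClass G c v i ≢ 0
    eClass≢0 {v} {w} {i} vw cw≡i e≡0 = contradiction (sum-map≡0⇒ _ e≡0 (∈-allFin w)) term≢0
      where
      term≢0 : (if adj v w ∧ ⌊ c w ≟ i ⌋ then 1 else 0) ≢ 0
      term≢0 rewrite vw with c w ≟ i
      ... | yes _    = λ ()
      ... | no  cw≢i = contradiction cw≡i cw≢i

    edgeMonochromatic⇒FAT : StrictlySurjective _≡_ c → (∀ u w → adj u w ≡ true → c u ≡ c w) →
                            IsFATColoring G c
    edgeMonochromatic⇒FAT surj mono =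
      surj , 0ℚ , 1ℚ , ℚP.≤-refl , ℚP.nonNegative⁻¹ 1ℚ , ℚP.nonNegative⁻¹ 1ℚ , ℚP.≤-refl ,
      λ v i → (λ cv≢i → trans (cong (ℕtoℚ G) (eClass≡0 v i λ w vw cw≡i → cv≢i (trans (mono v w vw) cw≡i)))
                              (sym (ℚP.*-zeroˡ (ℕtoℚ G (deg G v)))))
            , (λ cv≡i → trans (cong (ℕtoℚ G) (eClass≡deg v i λ w vw → trans (sym (mono v w vw)) cv≡i))
                              (sym (ℚP.*-identityˡ (ℕtoℚ G (deg G v)))))

    -- The α-half of the FAT condition at v, with α eliminated.
    FairAt : Fin n → Set
    FairAt v = ∀ {i j} → c v ≢ i → c v ≢ j → eClass G c v i ≡ eClass G c v j

    FAT⇒fairAt : IsFATColoring G c → ∀ v → FairAt v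
    FAT⇒fairAt (_ , _ , _ , _ , _ , _ , _ , fair) v {i} {j} cv≢i cv≢j =
      ℕtoℚ-injective {eClass G c v i} {eClass G c v j}
        (trans (proj₁ (fair v i) cv≢i) (sym (proj₁ (fair v j) cv≢j)))

    fairAt⇒rainbow : ∀ {v} → FairAt v → ∀ {w} → adj v w ≡ true → c w ≢ c v →
                     ∀ i → c v ≢ i → ∃ λ x → adj v x ≡ true × c x ≡ i
    fairAt⇒rainbow {v} fair {w} vw cw≢cv i cv≢i
      with any? (λ x → (adj v x BoolP.≟ true) ×-dec (c x ≟ i))
    ... | yes found = found
    ... | no  none  = contradiction (trans (fair cv≢w cv≢i) noneCount) (eClass≢0 vw refl)
      where
      cv≢w : c v ≢ c w
      cv≢w cv≡cw = cw≢cv (sym cv≡cw)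
      noneCount : eClass G c v i ≡ 0
      noneCount = eClass≡0 v i λ x vx cx≡i → none (x , vx , cx≡i)

module IsolatedPlusClique (p m : ℕ) where

  link : Fin p ⊎ Fin (suc m) → Fin p ⊎ Fin (suc m) → Bool
  link (inj₂ i) (inj₂ j) = not ⌊ i ≟ j ⌋
  link _        _        = false

  link-sym : ∀ x y → link x y ≡ link y x
  link-sym (inj₁ _) (inj₁ _) = refl
  link-sym (inj₁ _) (inj₂ _) = refl
  link-sym (inj₂ _) (inj₁ _) = refl
  link-sym (inj₂ i) (inj₂ j) with i ≟ j | j ≟ i
  ... | yes _   | yes _   = refl
  ... | no  _   | no  _   = refl
  ... | yes i≡j | no  j≢i = contradiction (sym i≡j) j≢i
  ... | no  i≢j | yes j≡i = contradiction (sym j≡i) i≢j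

  link-irrefl : ∀ x → link x x ≡ false
  link-irrefl (inj₁ _) = refl
  link-irrefl (inj₂ i) with i ≟ i
  ... | yes _   = refl
  ... | no  i≢i = contradiction refl i≢i

  link≡true⇒clique : ∀ x y → link x y ≡ true → ∃₂ λ i j → x ≡ inj₂ i × y ≡ inj₂ j × i ≢ j
  link≡true⇒clique (inj₂ i) (inj₂ j) ij with i ≟ j
  link≡true⇒clique (inj₂ i) (inj₂ j) () | yes _
  ... | no i≢j = i , j , refl , refl , i≢j

  graph : Graph
  graph = record
    { n        = p + suc m
    ; nonempty = ℕP.≤-trans (s≤s z≤n) (ℕP.m≤n+m (suc m) p)
    ; adj      = λ u v → link (splitAt p u) (splitAt p v)
    ; adj-sym  = λ u v → link-sym (splitAt p u) (splitAt p v)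
    ; irrefl   = λ v → link-irrefl (splitAt p v)
    }

  open Graph graph using (n; adj)

  isolated : Fin p → Fin n
  isolated i = i ↑ˡ suc m

  clique : Fin (suc m) → Fin n
  clique j = p ↑ʳ j

  isolated-adj : ∀ i w → adj (isolated i) w ≡ false
  isolated-adj i w rewrite splitAt-↑ˡ p i (suc m) = refl

  clique-adj : ∀ i j → i ≢ j → adj (clique i) (clique j) ≡ true
  clique-adj i j i≢j rewrite splitAt-↑ʳ p (suc m) i | splitAt-↑ʳ p (suc m) j with i ≟ j
  ... | yes i≡j = contradiction i≡j i≢j
  ... | no  _   = refl

  isolated≢clique : ∀ i j → isolated i ≢ clique j
  isolated≢clique i j eq
    with trans (sym (splitAt-↑ˡ p i (suc m))) (trans (cong (splitAt p) eq) (splitAt-↑ʳ p (suc m) j))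
  ... | ()

  adj⇒clique : ∀ {u w} → adj u w ≡ true →
               ∃₂ λ i j → splitAt p u ≡ inj₂ i × splitAt p w ≡ inj₂ j × i ≢ j
  adj⇒clique {u} {w} = link≡true⇒clique (splitAt p u) (splitAt p w)

  disconnected : Fin p → Disconnected graph
  disconnected i = isolated i , clique zero ,
    isolated⇒¬Reach graph (isolated-adj i) (isolated≢clique i zero)

  properColoring : ProperColoring graph (suc m)
  properColoring = cliqueIndex , proper
    where
    cliqueIndex : Fin n → Fin (suc m)
    cliqueIndex v = [ const zero , id ]′ (splitAt p v)
    proper : ∀ u w → adj u w ≡ true → cliqueIndex u ≢ cliqueIndex w
    proper u w uw with adj⇒clique uw
    ... | i , j , u≡i , w≡j , i≢j rewrite u≡i | w≡j = i≢j

  chromaticNumber : IsChromaticNumber graph (suc m)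
  chromaticNumber = properColoring , λ k → clique⇒χ≥ graph clique clique-adj

  fatColoring : HasFATColoring graph (suc p)
  fatColoring = colour , edgeMonochromatic⇒FAT graph colour surjective monochromatic
    where
    colour : Fin n → Fin (suc p)
    colour v = [ suc , const zero ]′ (splitAt p v)
    surjective : StrictlySurjective _≡_ colour
    surjective zero    = clique zero , cong [ suc , const zero ]′ (splitAt-↑ʳ p (suc m) zero)
    surjective (suc i) = isolated i , cong [ suc , const zero ]′ (splitAt-↑ˡ p i (suc m))
    monochromatic : ∀ u w → adj u w ≡ true → colour u ≡ colour w
    monochromatic u w uw with adj⇒clique uw
    ... | _ , _ , u≡i , w≡j , _ rewrite u≡i | w≡j = refl

  module _ {k} (c : Fin n → Fin k) where

    monochromaticClique⇒≤ : StrictlySurjective _≡_ c → (∀ j → c (clique j) ≡ c (clique zero)) →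
                            k ≤ suc p
    monochromaticClique⇒≤ surj mono = strictlySurjective⇒≥ colourOf surjective
      where
      colourOf : Fin (suc p) → Fin k
      colourOf zero    = c (clique zero)
      colourOf (suc i) = c (isolated i)
      surjective : StrictlySurjective _≡_ colourOf
      surjective x with surj x
      ... | v , cv≡x with splitAt p v in v≡
      ... | inj₁ i = suc i , trans (cong c (splitAt⁻¹-↑ˡ v≡)) cv≡x
      ... | inj₂ j = zero , trans (sym (mono j)) (trans (cong c (splitAt⁻¹-↑ʳ v≡)) cv≡x)

    bichromaticClique⇒≤ : FairAt graph c (clique zero) → ∀ j → c (clique j) ≢ c (clique zero) → k ≤ suc m
    bichromaticClique⇒≤ fair j cj≢c0 = strictlySurjective⇒≥ (λ i → c (clique i)) surjective
      where
      j≢0 : zero ≢ j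
      j≢0 refl = cj≢c0 refl
      surjective : StrictlySurjective _≡_ (λ i → c (clique i))
      surjective x with c (clique zero) ≟ x
      ... | yes c0≡x = zero , c0≡x
      ... | no  c0≢x with fairAt⇒rainbow graph c fair (clique-adj zero j j≢0) cj≢c0 x c0≢x
      ... | y , vy , cy≡x with adj⇒clique vy
      ... | _ , i , _ , y≡i , _ = i , trans (cong c (splitAt⁻¹-↑ʳ y≡i)) cy≡x

    fatColoring⇒≤ : m < p → IsFATColoring graph c → k ≤ suc p
    fatColoring⇒≤ m<p fat = byCases (all? λ j → c (clique j) ≟ c (clique zero))
      where
      byCases : Dec (∀ j → c (clique j) ≡ c (clique zero)) → k ≤ suc p
      byCases (yes mono)  = monochromaticClique⇒≤ (proj₁ fat) mono
      byCases (no  ¬mono) =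
        let j , cj≢c0 = ¬∀⟶∃¬ (suc m) _ (λ j → c (clique j) ≟ c (clique zero)) ¬mono
        in  ℕP.≤-trans (bichromaticClique⇒≤ (FAT⇒fairAt graph c fat (clique zero)) j cj≢c0)
                       (ℕP.m≤n⇒m≤1+n m<p)

  fatChromaticNumber : m < p → IsFATChromaticNumber graph (suc p)
  fatChromaticNumber m<p = fatColoring , λ k (c , fat) → fatColoring⇒≤ c m<p fat

theorem2p1 : (L₁ L₂ : ℕ) → 1 ≤ L₁ → L₁ < L₂ →
    Σ Graph λ G → Disconnected G × IsChromaticNumber G L₁ × IsFATChromaticNumber G L₂
theorem2p1 (suc m) (suc p) _ (s≤s m<p) =
  graph , disconnected (fromℕ< m<p) , chromaticNumber , fatChromaticNumber m<p
  where open IsolatedPlusClique p m
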